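{- For every integer $n \ge 2$, $h_4(n+1) = h_2(n) + h_4(n)$.
   Context: For a binary sequence $x = (x_1,\dots,x_n) \in \{0,1\}^n$ define the score $$S(x) = \sum_{i=1}^{n-1} I[x_i = x_{i+1} = 1] - \sum_{i=1}^{n-1} I[x_i = 1,\ x_{i+1} = 0].$$ Let $h_2(n)$ be the number of $x \in \{0,1\}^n$ with $x_n = 1$ and $S(x) = 1$, and $h_4(n)$ the number of $x \in \{0,1\}^n$ with $x_n = 1$ and $S(x) = -1$. -}

module Defs where

open import Data.Bool using (Bool; true; false)
open import Data.Nat using (ℕ; zero; suc)
open import Data.Integer using (ℤ; +_; -_; _+_; _-_)
open import Data.List using (List; []; _∷_; map; _++_; length; filter)
open import Data.Vec using (Vec; []; _∷_; last)
open import Relation.Nullary.Decidable using (_×-dec_)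
open import Relation.Binary.PropositionalEquality using (_≡_)
open import Data.Bool.Properties using () renaming (_≟_ to _≟ᵇ_)
open import Data.Integer.Properties using () renaming (_≟_ to _≟ℤ_)

-- all binary sequences of length n (true = 1, false = 0)
allSeqs : (n : ℕ) → List (Vec Bool n)
allSeqs zero = [] ∷ []
allSeqs (suc n) = map (false ∷_) (allSeqs n) ++ map (true ∷_) (allSeqs n)

pairScore : Bool → Bool → ℤ
pairScore true  true  = + 1
pairScore true  false = - (+ 1)
pairScore false _     = + 0

score : ∀ {n} → Vec Bool n → ℤ
score [] = + 0
score (x ∷ []) = + 0
score (x ∷ y ∷ xs) = pairScore x y + score (y ∷ xs)

count : ℤ → ℕ → ℕ
count s zero = 0
count s (suc n) =
  length (filter (λ x → (last x ≟ᵇ true) ×-dec (score x ≟ℤ s)) (allSeqs (suc n)))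

h₂ : ℕ → ℕ
h₂ n = count (+ 1) n

h₄ : ℕ → ℕ
h₄ n = count (- (+ 1)) n

{-# OPTIONS --safe #-}
-- Splitting off the first letter, h₄ (n + 1) counts the words 0x, which contribute h₄ n,
-- and the words 1x. Prepending 0 changes neither the score nor the last letter, so it
-- remains to match the words from 1 to 1 with score -1 against those from 0 to 1 with
-- score 1. Refine both counts by the number k of factors 10 ("cuts"): a word ending in 1
-- with score s and k cuts is a composition of its s + 2k + 1 ones into k + 1 runs together
-- with a composition of its zeros into k blocks, or k + 1 blocks if it starts with 0.
-- Score -1 with k + 1 cuts and score 1 with k cuts give the same zero blocks and split
-- 2k + 2 ones into k + 2 resp. k + 1 parts, and conjugation of compositions,
-- C(2k+1, k+1) = C(2k+1, k), matches the two.
module Submission where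

open import Defs
open import Data.Nat using (ℕ; suc; _+_; _≥_)
open import Relation.Binary.PropositionalEquality using (_≡_)

open import Data.Bool using (Bool; true; false)
open import Data.Bool.Properties using () renaming (_≟_ to _≟ᵇ_)
open import Data.Integer using (ℤ; +_; -[1+_]; 0ℤ; 1ℤ; -1ℤ) renaming (_+_ to _+ℤ_; _-_ to _-ℤ_)
open import Data.Integer.Properties using () renaming (_≟_ to _≟ℤ_)
import Data.Integer.Properties as ℤ
open import Data.Integer.Tactic.RingSolver using (solve-∀)
open import Data.List using (List; []; _∷_; map; _++_; length; filter)
import Data.List.Properties as List
open import Data.Nat using (zero; _*_)
open import Data.Nat.Combinatorics using (_C_; nCk≡nC[n∸k]; nCk+nC[k+1]≡[n+1]C[k+1])
open import Data.Nat.ListAction using (sum)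
open import Data.Nat.Properties
  using (+-identityʳ; +-comm; *-distribˡ-+; *-distribʳ-+; *-zeroʳ; m≤m+n; m+n∸m≡n; +-commutativeSemigroup)
open import Algebra.Properties.CommutativeSemigroup +-commutativeSemigroup
  using () renaming (interchange to +-interchange)
open import Data.Product using (_×_; _,_)
import Data.Product as Product
open import Data.Vec using (Vec; _∷_; last)
open import Function using (_∘_)
open import Relation.Binary.PropositionalEquality using (refl; sym; trans; cong; cong₂; module ≡-Reasoning)
open import Relation.Nullary.Decidable using (_×-dec_; does)
open import Relation.Unary using (Pred; Decidable; _≐_)

open ≡-Reasoning

length-filter-map : ∀ {a b p} {A : Set a} {B : Set b} {P : Pred B p} (P? : Decidable P)
                    (f : A → B) (xs : List A) →
                    length (filter P? (map f xs)) ≡ length (filter (P? ∘ f) xs)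
length-filter-map P? f [] = refl
length-filter-map P? f (x ∷ xs) with does (P? (f x))
... | true  = cong suc (length-filter-map P? f xs)
... | false = length-filter-map P? f xs

length-filter-allSeqs : ∀ {n p} {P : Pred (Vec Bool (suc n)) p} (P? : Decidable P) →
  length (filter P? (allSeqs (suc n)))
    ≡ length (filter (P? ∘ (false ∷_)) (allSeqs n)) + length (filter (P? ∘ (true ∷_)) (allSeqs n))
length-filter-allSeqs {n} P? = begin
  length (filter P? (map (false ∷_) (allSeqs n) ++ map (true ∷_) (allSeqs n)))
    ≡⟨ cong length (List.filter-++ P? (map (false ∷_) (allSeqs n)) _) ⟩
  length (filter P? (map (false ∷_) (allSeqs n)) ++ filter P? (map (true ∷_) (allSeqs n)))
    ≡⟨ List.length-++ (filter P? (map (false ∷_) (allSeqs n))) ⟩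
  length (filter P? (map (false ∷_) (allSeqs n))) + length (filter P? (map (true ∷_) (allSeqs n)))
    ≡⟨ cong₂ _+_ (length-filter-map P? (false ∷_) (allSeqs n))
                 (length-filter-map P? (true ∷_) (allSeqs n)) ⟩
  length (filter (P? ∘ (false ∷_)) (allSeqs n)) + length (filter (P? ∘ (true ∷_)) (allSeqs n)) ∎

countFrom : Bool → ℤ → ℕ → ℕ
countFrom a s m =
  length (filter (λ xs → (last (a ∷ xs) ≟ᵇ true) ×-dec (score (a ∷ xs) ≟ℤ s)) (allSeqs m))

count-suc : ∀ s m → count s (suc m) ≡ countFrom false s m + countFrom true s m
count-suc s m = length-filter-allSeqs {n = m} (λ x → (last x ≟ᵇ true) ×-dec (score x ≟ℤ s))

p+t≡s⇒t≡s-p : ∀ p t s → p +ℤ t ≡ s → t ≡ s -ℤ p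
p+t≡s⇒t≡s-p p t s refl = cancel p t
  where
  cancel : ∀ p t → t ≡ (p +ℤ t) -ℤ p
  cancel = solve-∀

t≡s-p⇒p+t≡s : ∀ p t s → t ≡ s -ℤ p → p +ℤ t ≡ s
t≡s-p⇒p+t≡s p t s refl = cancel p s
  where
  cancel : ∀ p s → p +ℤ (s -ℤ p) ≡ s
  cancel = solve-∀

countFrom-suc : ∀ a s m → countFrom a s (suc m)
  ≡ countFrom false (s -ℤ pairScore a false) m + countFrom true (s -ℤ pairScore a true) m
countFrom-suc a s m = trans (length-filter-allSeqs {n = m} _) (cong₂ _+_ (shift false) (shift true))
  where
  shift : ∀ b →
    length (filter (λ ys → (last (b ∷ ys) ≟ᵇ true) ×-dec (score (a ∷ b ∷ ys) ≟ℤ s)) (allSeqs m))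
      ≡ countFrom b (s -ℤ pairScore a b) m
  shift b = cong length (List.filter-≐ _ _ equivalent (allSeqs m))
    where
    equivalent : (λ ys → last (b ∷ ys) ≡ true × pairScore a b +ℤ score (b ∷ ys) ≡ s)
               ≐ (λ ys → last (b ∷ ys) ≡ true × score (b ∷ ys) ≡ s -ℤ pairScore a b)
    equivalent = Product.map₂ (p+t≡s⇒t≡s-p _ _ s) , Product.map₂ (t≡s-p⇒p+t≡s _ _ s)

countFrom-false-suc : ∀ s m → countFrom false s (suc m) ≡ countFrom false s m + countFrom true s m
countFrom-false-suc s m =
  trans (countFrom-suc false s m) (cong (λ t → countFrom false t m + countFrom true t m) (ℤ.+-identityʳ s))

count≡countFrom-false : ∀ s m → count s m ≡ countFrom false s m
count≡countFrom-false s zero    = refl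
count≡countFrom-false s (suc m) = trans (count-suc s m) (sym (countFrom-false-suc s m))

infixl 6 _⊕_

_⊕_ : List ℕ → List ℕ → List ℕ
[]       ⊕ q        = q
(x ∷ p)  ⊕ []       = x ∷ p
(x ∷ p)  ⊕ (y ∷ q)  = x + y ∷ p ⊕ q

coeff : List ℕ → ℕ → ℕ
coeff []      k       = 0
coeff (x ∷ p) zero    = x
coeff (x ∷ p) (suc k) = coeff p k

coeff-⊕ : ∀ p q k → coeff (p ⊕ q) k ≡ coeff p k + coeff q k
coeff-⊕ []      q       k       = refl
coeff-⊕ (x ∷ p) []      k       = sym (+-identityʳ _)
coeff-⊕ (x ∷ p) (y ∷ q) zero    = refl
coeff-⊕ (x ∷ p) (y ∷ q) (suc k) = coeff-⊕ p q k

sum-⊕ : ∀ p q → sum (p ⊕ q) ≡ sum p + sum q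
sum-⊕ []      q       = refl
sum-⊕ (x ∷ p) []      = sym (+-identityʳ _)
sum-⊕ (x ∷ p) (y ∷ q) = begin
  x + y + sum (p ⊕ q)       ≡⟨ cong (_+_ (x + y)) (sum-⊕ p q) ⟩
  x + y + (sum p + sum q)   ≡⟨ +-interchange x y (sum p) (sum q) ⟩
  x + sum p + (y + sum q)   ∎

sum-cong-coeff : ∀ p q → (∀ k → coeff p k ≡ coeff q k) → sum p ≡ sum q
sum-cong-coeff []      []      eq = refl
sum-cong-coeff []      (y ∷ q) eq = cong₂ _+_ (eq zero) (sum-cong-coeff [] q (eq ∘ suc))
sum-cong-coeff (x ∷ p) []      eq = cong₂ _+_ (eq zero) (sum-cong-coeff p [] (eq ∘ suc))
sum-cong-coeff (x ∷ p) (y ∷ q) eq = cong₂ _+_ (eq zero) (sum-cong-coeff p q (eq ∘ suc))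

-- The coefficient of t^k counts the words a ∷ xs of countFrom a s m with exactly k factors 10.
cutPolynomial : Bool → ℤ → ℕ → List ℕ
cutPolynomial a     s zero    = countFrom a s zero ∷ []
cutPolynomial false s (suc m) = cutPolynomial false s m ⊕ cutPolynomial true s m
cutPolynomial true  s (suc m) = (0 ∷ cutPolynomial false (s +ℤ 1ℤ) m) ⊕ cutPolynomial true (s -ℤ 1ℤ) m

sum-cutPolynomial : ∀ a s m → sum (cutPolynomial a s m) ≡ countFrom a s m
sum-cutPolynomial a     s zero    = +-identityʳ (countFrom a s zero)
sum-cutPolynomial false s (suc m) = begin
  sum (cutPolynomial false s m ⊕ cutPolynomial true s m)
    ≡⟨ sum-⊕ (cutPolynomial false s m) (cutPolynomial true s m) ⟩
  sum (cutPolynomial false s m) + sum (cutPolynomial true s m)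
    ≡⟨ cong₂ _+_ (sum-cutPolynomial false s m) (sum-cutPolynomial true s m) ⟩
  countFrom false s m + countFrom true s m
    ≡⟨ countFrom-false-suc s m ⟨
  countFrom false s (suc m) ∎
sum-cutPolynomial true  s (suc m) = begin
  sum ((0 ∷ cutPolynomial false (s +ℤ 1ℤ) m) ⊕ cutPolynomial true (s -ℤ 1ℤ) m)
    ≡⟨ sum-⊕ (0 ∷ cutPolynomial false (s +ℤ 1ℤ) m) (cutPolynomial true (s -ℤ 1ℤ) m) ⟩
  sum (cutPolynomial false (s +ℤ 1ℤ) m) + sum (cutPolynomial true (s -ℤ 1ℤ) m)
    ≡⟨ cong₂ _+_ (sum-cutPolynomial false (s +ℤ 1ℤ) m) (sum-cutPolynomial true (s -ℤ 1ℤ) m) ⟩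
  countFrom false (s +ℤ 1ℤ) m + countFrom true (s -ℤ 1ℤ) m
    ≡⟨ countFrom-suc true s m ⟨
  countFrom true s (suc m) ∎

-- Compositions of w into k positive parts, taken over ℤ so that negative totals (which
-- occur at the boundary of the recurrences) simply have none.
compositions : ℤ → ℕ → ℕ
compositions (+ zero)  zero    = 1
compositions (+ suc n) (suc k) = n C k
compositions _         _       = 0

compositions-pascal : ∀ w k → compositions (1ℤ +ℤ w) (suc k) ≡ compositions w k + compositions w (suc k)
compositions-pascal (+ zero)      zero    = refl
compositions-pascal (+ zero)      (suc k) = refl
compositions-pascal (+ suc n)     zero    = refl
compositions-pascal (+ suc n)     (suc k) = sym (nCk+nC[k+1]≡[n+1]C[k+1] n k)
compositions-pascal -[1+ zero ]   k       = refl
compositions-pascal -[1+ suc n ]  k       = refl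

compositions-conjugate : ∀ i j → compositions (+ suc (i + j)) (suc i) ≡ compositions (+ suc (i + j)) (suc j)
compositions-conjugate i j = trans (nCk≡nC[n∸k] (m≤m+n i j)) (cong ((i + j) C_) (m+n∸m≡n i j))

compositions-zero-parts : ∀ w m → compositions w 0 * compositions (+ suc m -ℤ w) 0 ≡ 0
compositions-zero-parts (+ zero)  m = refl
compositions-zero-parts (+ suc n) m = refl
compositions-zero-parts -[1+ n ]  m = refl

-- A word ending in 1 with score s and k cuts has k + 1 runs of ones holding s + k factors 11,
-- hence ones s k ones; its zeros form one block before each run but the first, and one
-- more when the word starts with 0.
ones : ℤ → ℕ → ℤ
ones s k = 1ℤ +ℤ s +ℤ + k +ℤ + k

zeroBlocks : Bool → ℕ → ℕ
zeroBlocks false k = suc k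
zeroBlocks true  k = k

arrangements : Bool → ℤ → ℤ → ℕ → ℕ
arrangements a w z k = compositions w (suc k) * compositions z (zeroBlocks a k)

cutCoefficient : Bool → ℤ → ℕ → ℕ → ℕ
cutCoefficient a s m k = arrangements a (ones s k) (+ suc m -ℤ ones s k) k

cutCoefficient≡arrangements : ∀ a s m k {w} → ones s k ≡ w →
  cutCoefficient a s m k ≡ arrangements a w (+ suc m -ℤ w) k
cutCoefficient≡arrangements a s m k = cong (λ w → arrangements a w (+ suc m -ℤ w) k)

arrangements-false-pascal : ∀ w z k →
  arrangements false w (1ℤ +ℤ z) k ≡ arrangements false w z k + arrangements true w z k
arrangements-false-pascal w z k = begin
  compositions w (suc k) * compositions (1ℤ +ℤ z) (suc k)
    ≡⟨ cong (compositions w (suc k) *_) (compositions-pascal z k) ⟩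
  compositions w (suc k) * (compositions z k + compositions z (suc k))
    ≡⟨ *-distribˡ-+ (compositions w (suc k)) (compositions z k) _ ⟩
  compositions w (suc k) * compositions z k + compositions w (suc k) * compositions z (suc k)
    ≡⟨ +-comm (compositions w (suc k) * compositions z k) _ ⟩
  compositions w (suc k) * compositions z (suc k) + compositions w (suc k) * compositions z k ∎

arrangements-true-pascal : ∀ w z k →
  arrangements true (1ℤ +ℤ w) z (suc k) ≡ arrangements false w z k + arrangements true w z (suc k)
arrangements-true-pascal w z k = begin
  compositions (1ℤ +ℤ w) (suc (suc k)) * compositions z (suc k)
    ≡⟨ cong (_* compositions z (suc k)) (compositions-pascal w (suc k)) ⟩
  (compositions w (suc k) + compositions w (suc (suc k))) * compositions z (suc k)
    ≡⟨ *-distribʳ-+ (compositions z (suc k)) (compositions w (suc k)) _ ⟩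
  compositions w (suc k) * compositions z (suc k) + compositions w (suc (suc k)) * compositions z (suc k) ∎

arrangements-true-no-cut : ∀ w m →
  arrangements true (1ℤ +ℤ w) (+ suc m -ℤ w) 0 ≡ arrangements true w (+ suc m -ℤ w) 0
arrangements-true-no-cut w m = begin
  compositions (1ℤ +ℤ w) 1 * compositions z 0
    ≡⟨ cong (_* compositions z 0) (compositions-pascal w 0) ⟩
  (compositions w 0 + compositions w 1) * compositions z 0
    ≡⟨ *-distribʳ-+ (compositions z 0) (compositions w 0) _ ⟩
  compositions w 0 * compositions z 0 + compositions w 1 * compositions z 0
    ≡⟨ cong (_+ compositions w 1 * compositions z 0) (compositions-zero-parts w m) ⟩
  compositions w 1 * compositions z 0 ∎
  where
  z = + suc m -ℤ w

ones-zero : ∀ s → ones s 0 ≡ 1ℤ +ℤ s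
ones-zero s = trans (ℤ.+-identityʳ _) (ℤ.+-identityʳ _)

countFrom-zero : ∀ a s → countFrom a s zero ≡ cutCoefficient a s zero zero
countFrom-zero a s = trans (singleton a s) (sym (cutCoefficient≡arrangements a s zero zero (ones-zero s)))
  where
  singleton : ∀ a s → countFrom a s zero ≡ arrangements a (1ℤ +ℤ s) (1ℤ -ℤ (1ℤ +ℤ s)) 0
  singleton true  (+ zero)      = refl
  singleton false (+ zero)      = refl
  singleton true  (+ suc n)     = sym (*-zeroʳ (compositions (+ suc (suc n)) 1))
  singleton false (+ suc n)     = sym (*-zeroʳ (compositions (+ suc (suc n)) 1))
  singleton true  -[1+ zero ]   = refl
  singleton false -[1+ zero ]   = refl
  singleton true  -[1+ suc n ]  = refl
  singleton false -[1+ suc n ]  = refl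

cutCoefficient-zero-suc : ∀ a s k → cutCoefficient a s zero (suc k) ≡ 0
cutCoefficient-zero-suc a s k = vanish a (ones s (suc k))
  where
  vanish : ∀ a w → arrangements a w (1ℤ -ℤ w) (suc k) ≡ 0
  vanish a (+ zero)          = refl
  vanish a (+ suc zero)      = refl
  vanish a (+ suc (suc n))   = *-zeroʳ (compositions (+ suc (suc n)) (suc (suc k)))
  vanish a -[1+ n ]          = refl

ones[s+1,k]≡ones[s-1,1+k] : ∀ s k → ones (s +ℤ 1ℤ) k ≡ ones (s -ℤ 1ℤ) (suc k)
ones[s+1,k]≡ones[s-1,1+k] s k = identity s (+ k)
  where
  identity : ∀ s K →
    1ℤ +ℤ (s +ℤ 1ℤ) +ℤ K +ℤ K ≡ 1ℤ +ℤ (s -ℤ 1ℤ) +ℤ (1ℤ +ℤ K) +ℤ (1ℤ +ℤ K)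
  identity = solve-∀

ones[s,k]≡1+ones[s-1,k] : ∀ s k → ones s k ≡ 1ℤ +ℤ ones (s -ℤ 1ℤ) k
ones[s,k]≡1+ones[s-1,k] s k = identity s (+ k)
  where
  identity : ∀ s K → 1ℤ +ℤ s +ℤ K +ℤ K ≡ 1ℤ +ℤ (1ℤ +ℤ (s -ℤ 1ℤ) +ℤ K +ℤ K)
  identity = solve-∀

[2+m]-w≡1+[[1+m]-w] : ∀ m w → + suc (suc m) -ℤ w ≡ 1ℤ +ℤ (+ suc m -ℤ w)
[2+m]-w≡1+[[1+m]-w] m w = identity (+ suc m) w
  where
  identity : ∀ M w → (1ℤ +ℤ M) -ℤ w ≡ 1ℤ +ℤ (M -ℤ w)
  identity = solve-∀

[2+m]-[1+w]≡[1+m]-w : ∀ m w → + suc (suc m) -ℤ (1ℤ +ℤ w) ≡ + suc m -ℤ w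
[2+m]-[1+w]≡[1+m]-w m w = identity (+ suc m) w
  where
  identity : ∀ M w → (1ℤ +ℤ M) -ℤ (1ℤ +ℤ w) ≡ M -ℤ w
  identity = solve-∀

coeff-cutPolynomial : ∀ a s m k → coeff (cutPolynomial a s m) k ≡ cutCoefficient a s m k
coeff-cutPolynomial a     s zero    zero    = countFrom-zero a s
coeff-cutPolynomial a     s zero    (suc k) = sym (cutCoefficient-zero-suc a s k)
coeff-cutPolynomial false s (suc m) k       = begin
  coeff (cutPolynomial false s m ⊕ cutPolynomial true s m) k
    ≡⟨ coeff-⊕ (cutPolynomial false s m) (cutPolynomial true s m) k ⟩
  coeff (cutPolynomial false s m) k + coeff (cutPolynomial true s m) k
    ≡⟨ cong₂ _+_ (coeff-cutPolynomial false s m k) (coeff-cutPolynomial true s m k) ⟩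
  arrangements false w (+ suc m -ℤ w) k + arrangements true w (+ suc m -ℤ w) k
    ≡⟨ arrangements-false-pascal w (+ suc m -ℤ w) k ⟨
  arrangements false w (1ℤ +ℤ (+ suc m -ℤ w)) k
    ≡⟨ cong (λ z → arrangements false w z k) ([2+m]-w≡1+[[1+m]-w] m w) ⟨
  cutCoefficient false s (suc m) k ∎
  where
  w = ones s k
coeff-cutPolynomial true  s (suc m) zero    = begin
  coeff ((0 ∷ cutPolynomial false (s +ℤ 1ℤ) m) ⊕ cutPolynomial true (s -ℤ 1ℤ) m) 0
    ≡⟨ coeff-⊕ (0 ∷ cutPolynomial false (s +ℤ 1ℤ) m) (cutPolynomial true (s -ℤ 1ℤ) m) 0 ⟩
  coeff (cutPolynomial true (s -ℤ 1ℤ) m) 0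
    ≡⟨ coeff-cutPolynomial true (s -ℤ 1ℤ) m 0 ⟩
  arrangements true w (+ suc m -ℤ w) 0
    ≡⟨ arrangements-true-no-cut w m ⟨
  arrangements true (1ℤ +ℤ w) (+ suc m -ℤ w) 0
    ≡⟨ cong (λ z → arrangements true (1ℤ +ℤ w) z 0) ([2+m]-[1+w]≡[1+m]-w m w) ⟨
  arrangements true (1ℤ +ℤ w) (+ suc (suc m) -ℤ (1ℤ +ℤ w)) 0
    ≡⟨ cutCoefficient≡arrangements true s (suc m) 0 (ones[s,k]≡1+ones[s-1,k] s 0) ⟨
  cutCoefficient true s (suc m) 0 ∎
  where
  w = ones (s -ℤ 1ℤ) 0
coeff-cutPolynomial true  s (suc m) (suc k) = begin
  coeff ((0 ∷ cutPolynomial false (s +ℤ 1ℤ) m) ⊕ cutPolynomial true (s -ℤ 1ℤ) m) (suc k)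
    ≡⟨ coeff-⊕ (0 ∷ cutPolynomial false (s +ℤ 1ℤ) m) (cutPolynomial true (s -ℤ 1ℤ) m) (suc k) ⟩
  coeff (cutPolynomial false (s +ℤ 1ℤ) m) k + coeff (cutPolynomial true (s -ℤ 1ℤ) m) (suc k)
    ≡⟨ cong₂ _+_ (coeff-cutPolynomial false (s +ℤ 1ℤ) m k)
                 (coeff-cutPolynomial true (s -ℤ 1ℤ) m (suc k)) ⟩
  cutCoefficient false (s +ℤ 1ℤ) m k + arrangements true w (+ suc m -ℤ w) (suc k)
    ≡⟨ cong (_+ arrangements true w (+ suc m -ℤ w) (suc k))
            (cutCoefficient≡arrangements false (s +ℤ 1ℤ) m k (ones[s+1,k]≡ones[s-1,1+k] s k)) ⟩
  arrangements false w (+ suc m -ℤ w) k + arrangements true w (+ suc m -ℤ w) (suc k)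
    ≡⟨ arrangements-true-pascal w (+ suc m -ℤ w) k ⟨
  arrangements true (1ℤ +ℤ w) (+ suc m -ℤ w) (suc k)
    ≡⟨ cong (λ z → arrangements true (1ℤ +ℤ w) z (suc k)) ([2+m]-[1+w]≡[1+m]-w m w) ⟨
  arrangements true (1ℤ +ℤ w) (+ suc (suc m) -ℤ (1ℤ +ℤ w)) (suc k)
    ≡⟨ cutCoefficient≡arrangements true s (suc m) (suc k) (ones[s,k]≡1+ones[s-1,k] s (suc k)) ⟨
  cutCoefficient true s (suc m) (suc k) ∎
  where
  w = ones (s -ℤ 1ℤ) (suc k)

countFrom-true-minus-one : ∀ m → countFrom true -1ℤ m ≡ countFrom false 1ℤ m
countFrom-true-minus-one m = begin
  countFrom true -1ℤ m
    ≡⟨ sum-cutPolynomial true -1ℤ m ⟨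
  sum (cutPolynomial true -1ℤ m)
    ≡⟨ sum-cong-coeff (cutPolynomial true -1ℤ m) (0 ∷ cutPolynomial false 1ℤ m) coefficients ⟩
  sum (cutPolynomial false 1ℤ m)
    ≡⟨ sum-cutPolynomial false 1ℤ m ⟩
  countFrom false 1ℤ m ∎
  where
  coefficients : ∀ k → coeff (cutPolynomial true -1ℤ m) k ≡ coeff (0 ∷ cutPolynomial false 1ℤ m) k
  coefficients zero    = coeff-cutPolynomial true -1ℤ m 0
  coefficients (suc k) = begin
    coeff (cutPolynomial true -1ℤ m) (suc k)
      ≡⟨ coeff-cutPolynomial true -1ℤ m (suc k) ⟩
    cutCoefficient true -1ℤ m (suc k)
      ≡⟨ cutCoefficient≡arrangements true -1ℤ m (suc k) (sym (ones[s+1,k]≡ones[s-1,1+k] 0ℤ k)) ⟩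
    compositions w (suc (suc k)) * compositions z (suc k)
      ≡⟨ cong (_* compositions z (suc k)) (compositions-conjugate (suc k) k) ⟩
    compositions w (suc k) * compositions z (suc k)
      ≡⟨ coeff-cutPolynomial false 1ℤ m k ⟨
    coeff (cutPolynomial false 1ℤ m) k ∎
    where
    w = ones 1ℤ k
    z = + suc m -ℤ w

h₄-suc : ∀ n → h₄ (suc n) ≡ h₂ n + h₄ n
h₄-suc n = begin
  h₄ (suc n)
    ≡⟨ count-suc -1ℤ n ⟩
  countFrom false -1ℤ n + countFrom true -1ℤ n
    ≡⟨ cong (_+_ (countFrom false -1ℤ n)) (countFrom-true-minus-one n) ⟩
  countFrom false -1ℤ n + countFrom false 1ℤ n
    ≡⟨ +-comm (countFrom false -1ℤ n) _ ⟩
  countFrom false 1ℤ n + countFrom false -1ℤ n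
    ≡⟨ cong₂ _+_ (count≡countFrom-false 1ℤ n) (count≡countFrom-false -1ℤ n) ⟨
  h₂ n + h₄ n ∎

-- The recurrence holds for every n.
lemma2 : (n : ℕ) → n ≥ 2 → h₄ (suc n) ≡ h₂ n + h₄ n
lemma2 n _ = h₄-suc n
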